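{- Let $\mathcal{T}=(\Sigma,\Delta,\sigma^0,\Lambda)$ be a concrete causal transition system with trace set $\mathsf{Tr}$, and let $\varphi_c,\varphi_e$ be causal formulas. Suppose Algorithm 1 (abstraction–refinement, described in the context) returns $\varphi_c$; that is, for an under-approximate trace set $\check{\mathsf{Tr}}\subseteq\mathsf{Tr}$ and an over-approximate causal transition system $\hat{\mathcal{T}}$ with trace set $\hat{\mathsf{Tr}}$ (both as described in the context): (i) AC1 holds in $\check{\mathsf{Tr}}$: there is $\check\tau\in\check{\mathsf{Tr}}$ with $\check\tau\models \neg\varphi_e\,\mathcal{U}\,(\varphi_c\wedge\Diamond\varphi_e)$; (ii) AC2(a) holds in $\check{\mathsf{Tr}}$: there is $\check\tau'\in\check{\mathsf{Tr}}$ with $\check\tau'\models\Box(\neg\varphi_c\wedge\neg\varphi_e)$ and ($\check\tau\not\equiv_Z\check\tau'$ or $\check\tau\not\equiv_W\check\tau'$); (iii) AC2(b) holds in $\hat{\mathcal{T}}$: for every $\hat\tau''\in\hat{\mathsf{Tr}}$, if $\hat\tau''\models\neg\varphi_e\,\mathcal{U}\,\varphi_c$ and $\check\tau\equiv_Z\hat\tau''$ and $\check\tau\not\equiv_W\hat\tau''$, then $\hat\tau''\models\Diamond\varphi_e$. Then $\varphi_c$ is an actual cause of $\varphi_e$ in $\mathcal{T}$, i.e.: AC1: there exists $\tau\in\mathsf{Tr}$ with $\tau\models\neg\varphi_e\,\mathcal{U}\,(\varphi_c\wedge\Diamond\varphi_e)$; AC2(a): there exists $\tau'\in\mathsf{Tr}$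 with $\tau'\models\Box(\neg\varphi_c\wedge\neg\varphi_e)$ and ($\tau\not\equiv_Z\tau'$ or $\tau\not\equiv_W\tau'$); AC2(b): for all $\tau''\in\mathsf{Tr}$, if $\tau''\models\neg\varphi_e\,\mathcal{U}\,\varphi_c$ and $\tau\equiv_Z\tau''$ and $\tau\not\equiv_W\tau''$, then $\tau''\models\Diamond\varphi_e$.
   Context: A causal model has exogenous variables $\mathcal{U}$, endogenous variables $\mathcal{V}$, each variable $Y$ ranging over a nonempty set $\mathcal{R}(Y)$; a state is a valuation of the variables. A causal transition system $\mathcal{T}=(\Sigma,\Delta,\sigma^0,\Lambda)$ has state set $\Sigma$ (valuations of $\mathcal{U}\cup\mathcal{V}$), transition relation $\Delta$ (given by the structural equations, acyclic), initial state $\sigma^0$ fixed by the context (values of exogenous variables), and labelling $\Lambda$ assigning to states atomic propositions from a set $\mathsf{AP}$ (given by causal formulas, i.e. Boolean combinations of primitive events $X=x$). A path is $\sigma_0\sigma_1\ldots$ with $\sigma_0=\sigma^0$ and $(\sigma_i,\sigma_{i+1})\in\Delta$; its trace is $\Lambda(\sigma_0)\Lambda(\sigma_1)\ldots$, and $\mathsf{Tr}$ is the set of all traces. For a state formula $p$: $\tau\models\Box p$ iff $\tau_i\models p$ for all $i\ge0$; $\tau\models\Diamond p$ iff $\tau_i\models p$ for some $i\ge0$; $\tau\models p\,\mathcal{U}\,q$ iff there is $i\ge0$ with $\tau_i\models q$ and $\tau_j\models p$ for all $j<i$. The endogenous variables are partitioned into disjoint sets $Z$ (the causal path, containing the variables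 of the cause) and $W$; for traces $\tau,\tau'$, $\tau\equiv_Z\tau'$ means they agree on the values of all variables in $Z$ at every position (similarly $\equiv_W$). Algorithm 1 works as follows. The under-approximation $\check{\mathsf{Tr}}$ is a subset of $\mathsf{Tr}$ (chosen by a mapping $\check h$ with $\check h(\mathsf{Tr})\subseteq\mathsf{Tr}$, enlarged during refinement); an SMT query on $\check{\mathsf{Tr}}$ for AC1 $\wedge$ AC2(a) yields $\varphi_c$ and witnesses $\check\tau,\check\tau'$. Then an over-approximation $\hat{\mathcal{T}}=(\hat\Sigma,\hat\Delta,\hat\sigma^0,\hat\Lambda)$ is built from an over-approximation state mapping $\hat h$ sending concrete states to abstract states (merging nearby states, possibly adding states not in $\Sigma$), so that every concrete trace $\tau''$ is mapped to an abstract trace $\hat\tau''\in\hat{\mathsf{Tr}}$, the abstraction preserves state valuations and the truth of $\varphi_c,\varphi_e$ at corresponding states; and (Assumption 1) $\hat h$ preserves $Z$-equality of traces: for concrete transitions $(\sigma_0,\sigma_1),(\sigma_0',\sigma_1')$, if $\sigma_0\equiv_Z\sigma_0'$ and $\sigma_1\not\equiv_Z\sigma_1'$ then $\sigma_0\equiv_Z\hat h(\sigma_0')$ and $\sigma_1\not\equiv_Z\hat h(\sigma_1')$. An SMT query checks AC2(b) on $\hat{\mathcal{T}}$; if it fails, $\hat{\mathcal{T}}$ is refined by removing counterexample states in $\hat\Sigma$ not corresponding to $\Sigma$ (or $\check{\mathsf{Tr}}$ is enlarged), and upon success $\varphi_c$ is returned. The minimality condition AC3 is omitted from the notion of actual cause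 here. -}

module Defs where

open import Data.Nat using (ℕ; zero; suc; _≤_; _<_)
open import Data.Product using (Σ; _×_; _,_; ∃)
open import Data.Sum using (_⊎_)
open import Data.Empty using (⊥)
open import Relation.Nullary using (¬_)
open import Relation.Binary.PropositionalEquality using (_≡_)

record Vars : Set₁ where
  field
    Var       : Set
    Range     : Var → Set
    range-ne  : (Y : Var) → Range Y
    Endo      : Var → Set                 -- membership in 𝓥 (others are 𝓤)
    Z         : Var → Set
    W         : Var → Set
    Z⊆Endo    : ∀ Y → Z Y → Endo Y
    W⊆Endo    : ∀ Y → W Y → Endo Y
    Endo⊆Z∪W  : ∀ Y → Endo Y → Z Y ⊎ W Y
    Z∩W=∅     : ∀ Y → Z Y → W Y → ⊥

open Vars public

Valuation : Vars → Set
Valuation V = (Y : Var V) → Range V Y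

data Formula (V : Vars) : Set where
  _≐_  : (X : Var V) → Range V X → Formula V
  ¬ᶠ_  : Formula V → Formula V
  _∧ᶠ_ : Formula V → Formula V → Formula V
  _∨ᶠ_ : Formula V → Formula V → Formula V

_⊨ᶠ_ : {V : Vars} → Valuation V → Formula V → Set
σ ⊨ᶠ (X ≐ x)  = σ X ≡ x
σ ⊨ᶠ (¬ᶠ φ)   = ¬ (σ ⊨ᶠ φ)
σ ⊨ᶠ (φ ∧ᶠ ψ) = (σ ⊨ᶠ φ) × (σ ⊨ᶠ ψ)
σ ⊨ᶠ (φ ∨ᶠ ψ) = (σ ⊨ᶠ φ) ⊎ (σ ⊨ᶠ ψ)

-- Every state carries a
-- valuation; the labelling Λ is the set of causal formulas true at
-- that valuation, so a trace is recorded as its sequence of valuations.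

record CTS (V : Vars) : Set₁ where
  field
    State : Set
    val   : State → Valuation V
    Δ     : State → State → Set
    init  : State

open CTS public

record Path {V : Vars} (T : CTS V) : Set where
  field
    at      : ℕ → State T
    starts  : at 0 ≡ init T
    steps   : ∀ i → Δ T (at i) (at (suc i))

open Path public

Trace : Vars → Set
Trace V = ℕ → Valuation V

IsTrace : {V : Vars} → CTS V → Trace V → Set
IsTrace T τ = Σ (Path T) λ p → ∀ i → τ i ≡ val T (at p i)

data LTL (V : Vars) : Set where
  st   : Formula V → LTL V
  ¬ₗ_  : LTL V → LTL V
  _∧ₗ_ : LTL V → LTL V → LTL V
  □_   : LTL V → LTL V
  ◇_   : LTL V → LTL V
  _𝓤_  : LTL V → LTL V → LTL V

_[_]⊨_ : {V : Vars} → Trace V → ℕ → LTL V → Set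
τ [ i ]⊨ st φ     = τ i ⊨ᶠ φ
τ [ i ]⊨ (¬ₗ ψ)   = ¬ (τ [ i ]⊨ ψ)
τ [ i ]⊨ (ψ ∧ₗ χ) = (τ [ i ]⊨ ψ) × (τ [ i ]⊨ χ)
τ [ i ]⊨ (□ ψ)    = ∀ k → i ≤ k → τ [ k ]⊨ ψ
τ [ i ]⊨ (◇ ψ)    = Σ ℕ λ k → i ≤ k × τ [ k ]⊨ ψ
τ [ i ]⊨ (ψ 𝓤 χ)  = Σ ℕ λ k → i ≤ k × (τ [ k ]⊨ χ) × (∀ j → i ≤ j → j < k → τ [ j ]⊨ ψ)

_⊨_ : {V : Vars} → Trace V → LTL V → Set
τ ⊨ ψ = τ [ 0 ]⊨ ψ

_≡[Z]_ : {V : Vars} → Trace V → Trace V → Set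
_≡[Z]_ {V} τ τ' = ∀ i (Y : Var V) → Z V Y → τ i Y ≡ τ' i Y

_≡[W]_ : {V : Vars} → Trace V → Trace V → Set
_≡[W]_ {V} τ τ' = ∀ i (Y : Var V) → W V Y → τ i Y ≡ τ' i Y

_≡ˢ[Z]_ : {V : Vars} → Valuation V → Valuation V → Set
_≡ˢ[Z]_ {V} σ σ' = ∀ (Y : Var V) → Z V Y → σ Y ≡ σ' Y

-- The three conditions (AC3 omitted), for a trace τ, parametrised by
-- the trace sets used for τ/τ' (TrA) and for τ'' (TrB).

AC1 : {V : Vars} → Formula V → Formula V → Trace V → Set
AC1 φc φe τ = τ ⊨ ((¬ₗ st φe) 𝓤 (st φc ∧ₗ (◇ st φe)))

AC2a : {V : Vars} → Formula V → Formula V → Trace V → Trace V → Set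
AC2a {V} φc φe τ τ' = (τ' ⊨ (□ ((¬ₗ st φc) ∧ₗ (¬ₗ st φe))))
                × ((¬ (_≡[Z]_ {V} τ τ')) ⊎ (¬ (_≡[W]_ {V} τ τ')))

AC2b : {V : Vars} → (Trace V → Set) → Formula V → Formula V → Trace V → Set
AC2b {V} TrB φc φe τ = ∀ τ'' → TrB τ''
  → τ'' ⊨ ((¬ₗ st φe) 𝓤 st φc)
  → _≡[Z]_ {V} τ τ''
  → ¬ (_≡[W]_ {V} τ τ'')
  → τ'' ⊨ (◇ st φe)

CauseConditions : {V : Vars} → (Trace V → Set) → (Trace V → Set)
  → Formula V → Formula V → Set
CauseConditions {V} TrA TrB φc φe =
  Σ (Trace V) λ τ → TrA τ × AC1 φc φe τ
    × (Σ (Trace V) λ τ' → TrA τ' × AC2a φc φe τ τ')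
    × AC2b TrB φc φe τ

IsActualCause : {V : Vars} → CTS V → Formula V → Formula V → Set
IsActualCause T φc φe = CauseConditions (IsTrace T) (IsTrace T) φc φe

record OverApprox {V : Vars} (T T̂ : CTS V) : Set₁ where
  field
    ĥ          : State T → State T̂
    val-pres   : ∀ s → val T̂ (ĥ s) ≡ val T s
    init-pres  : ĥ (init T) ≡ init T̂
    step-pres  : ∀ s s' → Δ T s s' → Δ T̂ (ĥ s) (ĥ s')
    assumption1 : ∀ s₀ s₁ s₀' s₁' → Δ T s₀ s₁ → Δ T s₀' s₁'
      → _≡ˢ[Z]_ {V} (val T s₀) (val T s₀') → ¬ (_≡ˢ[Z]_ {V} (val T s₁) (val T s₁'))
      → (_≡ˢ[Z]_ {V} (val T s₀) (val T̂ (ĥ s₀'))) × ¬ (_≡ˢ[Z]_ {V} (val T s₁) (val T̂ (ĥ s₁')))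

-- Under-approximation is sound for the existential conditions AC1 and AC2(a):
-- their witnesses are concrete traces.  Over-approximation is sound for the
-- universal condition AC2(b): ĥ maps every concrete path to an abstract path
-- with the same valuations, so every concrete trace is an abstract trace.
module Submission where

open import Defs
open import Data.Product using (_,_)
open import Relation.Unary using (_⊆′_)
open import Relation.Binary.PropositionalEquality using (sym; trans; cong)

IsTrace-⊆-overApprox : {V : Vars} {T T̂ : CTS V} → OverApprox T T̂ → IsTrace T ⊆′ IsTrace T̂
IsTrace-⊆-overApprox {T̂ = T̂} O τ (p , τ≡p) = p̂ , λ i → trans (τ≡p i) (sym (val-pres (at p i)))
  where
  open OverApprox O
  p̂ : Path T̂
  p̂ = record { at     = λ i → ĥ (at p i)
             ; starts = trans (cong ĥ (starts p)) init-pres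
             ; steps  = λ i → step-pres _ _ (steps p i) }

AC2b-antitone : {V : Vars} {B B' : Trace V → Set} {φc φe : Formula V} {τ : Trace V}
  → B' ⊆′ B → AC2b B φc φe τ → AC2b B' φc φe τ
AC2b-antitone B'⊆B ac2b τ'' inB' = ac2b τ'' (B'⊆B τ'' inB')

CauseConditions-mono : {V : Vars} {A A' B B' : Trace V → Set} {φc φe : Formula V}
  → A ⊆′ A' → B' ⊆′ B
  → CauseConditions A B φc φe → CauseConditions A' B' φc φe
CauseConditions-mono A⊆A' B'⊆B (τ , inA , ac1 , (τ' , inA' , ac2a) , ac2b) =
  τ , A⊆A' τ inA , ac1 , (τ' , A⊆A' τ' inA' , ac2a) , AC2b-antitone B'⊆B ac2b

theorem1 : {V : Vars} (T T̂ : CTS V) (φc φe : Formula V)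
    (Ťr : Trace V → Set) → (∀ τ → Ťr τ → IsTrace T τ)
    → OverApprox T T̂
    → CauseConditions Ťr (IsTrace T̂) φc φe
    → IsActualCause T φc φe
theorem1 T T̂ φc φe Ťr Ťr⊆Tr O =
  CauseConditions-mono Ťr⊆Tr (IsTrace-⊆-overApprox O)
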